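{- Suppose $\pi\in S_n$ contains an occurrence of the pattern $32\overline{4}1$ that involves the entry $1$, and suppose $\sigma\in S_n$ satisfies $s(\sigma)=\pi$. Then $\sigma$ also contains an occurrence of the pattern $32\overline{4}1$ that involves the entry $1$. Furthermore, there exist distinct entries $c,d\in\{3,\ldots,n\}$ that appear to the left of $1$ in $\sigma$ and appear to the right of $1$ in $\pi$.
   Context: $S_n$ is the set of permutations of $\{1,\ldots,n\}$ in one-line notation. West's stack-sorting map $s$ is defined recursively: $s$ sends the empty permutation to itself, and for a nonempty permutation $\pi=LmR$ with $m$ its largest entry, $s(\pi)=s(L)\,s(R)\,m$. Entries $\pi_{i_1},\pi_{i_2},\pi_{i_3}$ of $\pi=\pi_1\cdots\pi_n$ with $i_1<i_2<i_3$ form an occurrence of the barred pattern $32\overline{4}1$ if $\pi_{i_1}>\pi_{i_2}>\pi_{i_3}$ and $\pi_j<\pi_{i_1}$ for all $i_2<j<i_3$; the occurrence involves the entry $1$ if one of these three entries equals $1$. -}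

module Defs where

open import Data.Nat using (ℕ; zero; suc; _<_; _≤_; _⊔_)
open import Data.Nat.Properties using (_≤?_)
open import Data.List using (List; []; _∷_; _++_; length; lookup; foldr; upTo; map)
open import Data.List.Relation.Binary.Permutation.Propositional using (_↭_)
open import Data.Fin using (Fin; toℕ)
open import Data.Product using (Σ; _×_; _,_; ∃-syntax)
open import Data.Sum using (_⊎_)
open import Relation.Binary.PropositionalEquality using (_≡_; _≢_)
open import Relation.Nullary using (yes; no)

-- Permutations of {1,...,n} in one-line notation: lists that are a
-- rearrangement of [1, 2, ..., n].
oneToN : ℕ → List ℕ
oneToN n = map suc (upTo n)

IsPerm : ℕ → List ℕ → Set
IsPerm n π = π ↭ oneToN n

-- largest entry of a list (0 for the empty list; entries are ≥ 1)
maxL : List ℕ → ℕ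
maxL = foldr _⊔_ 0

splitAt : ℕ → List ℕ → List ℕ × List ℕ
splitAt m [] = [] , []
splitAt m (x ∷ xs) with x Data.Nat.≟ m
... | yes _ = [] , xs
... | no _ with splitAt m xs
...   | (L , R) = x ∷ L , R

-- The recursion is on the length; the fuel argument is the length
-- bound, which always suffices when started with fuel = length.
stackSortFuel : ℕ → List ℕ → List ℕ
stackSortFuel _ [] = []
stackSortFuel zero (x ∷ xs) = x ∷ xs   -- unreachable when fuel = length
stackSortFuel (suc k) (x ∷ xs) with splitAt (maxL (x ∷ xs)) (x ∷ xs)
... | (L , R) = stackSortFuel k L ++ stackSortFuel k R ++ (maxL (x ∷ xs) ∷ [])

s : List ℕ → List ℕ
s π = stackSortFuel (length π) π

Occ3241 : (π : List ℕ) → Fin (length π) → Fin (length π) → Fin (length π) → Set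
Occ3241 π i₁ i₂ i₃ =
  toℕ i₁ < toℕ i₂ × toℕ i₂ < toℕ i₃ ×
  lookup π i₂ < lookup π i₁ × lookup π i₃ < lookup π i₂ ×
  ((j : Fin (length π)) → toℕ i₂ < toℕ j → toℕ j < toℕ i₃ → lookup π j < lookup π i₁)

Contains3241With1 : List ℕ → Set
Contains3241With1 π =
  ∃[ i₁ ] ∃[ i₂ ] ∃[ i₃ ] (Occ3241 π i₁ i₂ i₃ ×
     (lookup π i₁ ≡ 1 ⊎ lookup π i₂ ≡ 1 ⊎ lookup π i₃ ≡ 1))

LeftOf : List ℕ → ℕ → ℕ → Set
LeftOf π a b = ∃[ i ] ∃[ j ] (lookup π i ≡ a × lookup π j ≡ b × toℕ i < toℕ j)

module Submission where

-- For x < y, the entry y precedes x in s(σ) exactly when some entry larger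
-- than y lies between y and x in σ.  Let a b 1 be the occurrence in π = s(σ).
-- As a precedes 1 in π, some entry larger than a lies between a and 1 in σ;
-- let c be the largest, which by maximality follows 1 in π.  Moreover c
-- precedes b in σ: otherwise the largest entry g between a and b in σ would
-- lie between b and 1 in π and exceed a, against the barred condition.  So
-- the entry larger than b separating b from 1 in σ lies between c and 1 and
-- is at least 3, and the largest entry d between c and 1 in σ yields the
-- occurrence c d 1 in σ; like c, it follows 1 in π.

open import Defs
open import Data.Nat using (ℕ; zero; suc; _+_; _≤_; _<_; z≤n; s≤s; z<s)
open import Data.Nat.Properties
open import Data.Fin using (Fin; toℕ; zero; suc)
open import Data.Fin.Properties using (toℕ-injective)
open import Data.List using (List; []; _∷_; _++_; [_]; length; lookup; filter; allFin)
open import Data.List.Properties using (length-++; foldr-forcesᵇ)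
open import Data.List.Extrema.Nat using (argmax; argmax-all; f[xs]≤f[argmax])
open import Data.List.Membership.Propositional using (_∈_; _∉_)
open import Data.List.Membership.Propositional.Properties
  using (∈-++⁺ˡ; ∈-++⁺ʳ; ∈-++⁻; ∈-lookup; ∈-filter⁺; ∈-allFin; ∈-map⁻; ∈-upTo⁻)
open import Data.List.Relation.Unary.Any using (here; there; index)
open import Data.List.Relation.Unary.Any.Properties using (lookup-index)
open import Data.List.Relation.Unary.All as All using (All; _∷_)
open import Data.List.Relation.Unary.All.Properties using (++⁻ˡ; ++⁻ʳ; all-filter)
open import Data.List.Relation.Unary.AllPairs using (_∷_)
open import Data.List.Relation.Unary.Unique.Propositional using (Unique)
import Data.List.Relation.Unary.Unique.Propositional.Properties as Unique
open import Data.List.Relation.Binary.Permutation.Propositional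
  using (_↭_; ↭-refl; ↭-sym; ↭⇒↭ₛ; module PermutationReasoning)
open import Data.List.Relation.Binary.Permutation.Propositional.Properties
  using (++⁺; ++⁺ˡ; ++⁺ʳ; ++-comm; ∈-resp-↭; All-resp-↭)
open import Data.Product using (_×_; _,_; proj₁; proj₂; ∃-syntax)
open import Data.Product.Function.NonDependent.Propositional using (_×-⇔_)
open import Data.Sum as Sum using (_⊎_; inj₁; inj₂)
open import Data.Sum.Function.Propositional using (_⊎-⇔_)
open import Data.Empty using (⊥-elim)
open import Function.Bundles using (_⇔_; mk⇔; Equivalence)
open import Function.Construct.Symmetry using (⇔-sym)
open import Function.Related.Propositional using (module EquationalReasoning)
open import Relation.Binary using (tri<; tri≈; tri>)
open import Relation.Binary.PropositionalEquality
  using (_≡_; _≢_; refl; sym; trans; cong; subst; setoid)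
open import Relation.Nullary using (yes; no; ¬_)
open import Relation.Nullary.Decidable using (_×-dec_)
open import Relation.Unary using (Decidable)
import Data.List.Relation.Binary.Permutation.Setoid.Properties (setoid ℕ) as Setoid

maxL-bounds : ∀ xs → All (_≤ maxL xs) xs
maxL-bounds xs = foldr-forcesᵇ (λ m n m⊔n≤ → m⊔n≤o⇒m≤o m n m⊔n≤ , m⊔n≤o⇒n≤o m n m⊔n≤) 0 xs ≤-refl

maxL-∈ : ∀ x xs → maxL (x ∷ xs) ∈ x ∷ xs
maxL-∈ x [] = here (⊔-identityʳ x)
maxL-∈ x (y ∷ ys) with ⊔-sel x (maxL (y ∷ ys))
... | inj₁ eq = here eq
... | inj₂ eq = there (subst (_∈ y ∷ ys) (sym eq) (maxL-∈ y ys))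

splitAt-++ : ∀ {m} xs → m ∈ xs → xs ≡ proj₁ (splitAt m xs) ++ m ∷ proj₂ (splitAt m xs)
splitAt-++ {m} (x ∷ xs) m∈ with x ≟ m
... | yes refl = refl
... | no x≢m with m∈
...   | here m≡x = ⊥-elim (x≢m (sym m≡x))
...   | there m∈xs = cong (x ∷_) (splitAt-++ xs m∈xs)

splitAt-∉ : ∀ m xs → m ∉ proj₁ (splitAt m xs)
splitAt-∉ m (x ∷ xs) m∈ with x ≟ m | m∈
... | yes _ | ()
... | no x≢m | here m≡x = x≢m (sym m≡x)
... | no x≢m | there m∈L = splitAt-∉ m xs m∈L

module MaxSplit (x : ℕ) (xs : List ℕ) where
  top : ℕ
  top = maxL (x ∷ xs)

  left right : List ℕ
  left = proj₁ (splitAt top (x ∷ xs))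
  right = proj₂ (splitAt top (x ∷ xs))

  split-≡ : x ∷ xs ≡ left ++ top ∷ right
  split-≡ = splitAt-++ (x ∷ xs) (maxL-∈ x xs)

  top∉left : top ∉ left
  top∉left = splitAt-∉ top (x ∷ xs)

  private
    bounded : All (_≤ top) (left ++ top ∷ right)
    bounded = subst (All (_≤ top)) split-≡ (maxL-bounds (x ∷ xs))

  left≤top : All (_≤ top) left
  left≤top = ++⁻ˡ left bounded

  right≤top : All (_≤ top) right
  right≤top = All.tail (++⁻ʳ left bounded)

  private
    length-split : suc (length xs) ≡ length left + suc (length right)
    length-split = trans (cong length split-≡) (length-++ left)

  length-left : length left ≤ length xs
  length-left = ≤-pred (subst (length left <_) (sym length-split) (m<m+n (length left) z<s))

  length-right : length right ≤ length xs
  length-right =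
    ≤-pred (subst (length right <_) (sym length-split) (m≤n+m (suc (length right)) (length left)))

stackSortFuel-↭ : ∀ k xs → stackSortFuel k xs ↭ xs
stackSortFuel-↭ k [] = ↭-refl
stackSortFuel-↭ zero (x ∷ xs) = ↭-refl
stackSortFuel-↭ (suc k) (x ∷ xs) = begin
  stackSortFuel k left ++ stackSortFuel k right ++ [ top ]
    ↭⟨ ++⁺ (stackSortFuel-↭ k left) (++⁺ʳ [ top ] (stackSortFuel-↭ k right)) ⟩
  left ++ right ++ [ top ]  ↭⟨ ++⁺ˡ left (++-comm right [ top ]) ⟩
  left ++ top ∷ right       ≡⟨ split-≡ ⟨
  x ∷ xs                    ∎
  where
  open MaxSplit x xs
  open PermutationReasoning

-- Relative order of entries

data Somewhere (P : ℕ → List ℕ → Set) : List ℕ → Set where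
  here  : ∀ {z xs} → P z xs → Somewhere P (z ∷ xs)
  there : ∀ {z xs} → Somewhere P xs → Somewhere P (z ∷ xs)

Somewhere-map : ∀ {P Q : ℕ → List ℕ → Set} → (∀ {z t} → P z t → Q z t) →
                ∀ {xs} → Somewhere P xs → Somewhere Q xs
Somewhere-map f (here p)  = here (f p)
Somewhere-map f (there p) = there (Somewhere-map f p)

module _ {P : ℕ → List ℕ → Set} where

  Somewhere-++⁺ʳ : ∀ xs {ys} → Somewhere P ys → Somewhere P (xs ++ ys)
  Somewhere-++⁺ʳ []       p = p
  Somewhere-++⁺ʳ (_ ∷ xs) p = there (Somewhere-++⁺ʳ xs p)

  Somewhere-++⁺ˡ : ∀ {xs ys} → (∀ {z t} → P z t → P z (t ++ ys)) →
                   Somewhere P xs → Somewhere P (xs ++ ys)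
  Somewhere-++⁺ˡ ext (here p)  = here (ext p)
  Somewhere-++⁺ˡ ext (there p) = there (Somewhere-++⁺ˡ ext p)

  Somewhere-++⁺ : ∀ {xs ys z} → z ∈ xs → (∀ {t} → P z (t ++ ys)) → Somewhere P (xs ++ ys)
  Somewhere-++⁺ {_ ∷ xs} (here refl) p = here p
  Somewhere-++⁺ (there z∈xs) p = there (Somewhere-++⁺ z∈xs p)

  Somewhere-++⁻ : ∀ xs {ys} {Q : ℕ → Set} → (∀ {z} t → P z (t ++ ys) → P z t ⊎ Q z) →
                  Somewhere P (xs ++ ys) →
                  Somewhere P xs ⊎ Somewhere P ys ⊎ ∃[ z ] (z ∈ xs × Q z)
  Somewhere-++⁻ []       split p = inj₂ (inj₁ p)
  Somewhere-++⁻ (z ∷ xs) split (here p) with split xs p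
  ... | inj₁ q = inj₁ (here q)
  ... | inj₂ q = inj₂ (inj₂ (z , here refl , q))
  Somewhere-++⁻ (z ∷ xs) split (there p) with Somewhere-++⁻ xs split p
  ... | inj₁ q                  = inj₁ (there q)
  ... | inj₂ (inj₁ q)           = inj₂ (inj₁ q)
  ... | inj₂ (inj₂ (w , w∈ , q)) = inj₂ (inj₂ (w , there w∈ , q))

Before : ℕ → ℕ → List ℕ → Set
Before y x = Somewhere (λ z t → z ≡ y × x ∈ t)

Bridge : ℕ → ℕ → List ℕ → Set
Bridge y x = Somewhere (λ w t → y < w × x ∈ t)

Bridged : ℕ → ℕ → List ℕ → Set
Bridged y x = Somewhere (λ z t → z ≡ y × Bridge y x t)

module _ {y x : ℕ} where

  Before-++⁺ˡ : ∀ {xs ys} → Before y x xs → Before y x (xs ++ ys)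
  Before-++⁺ˡ = Somewhere-++⁺ˡ λ (z≡y , x∈t) → z≡y , ∈-++⁺ˡ x∈t

  Before-++⁺ : ∀ {xs ys} → y ∈ xs → x ∈ ys → Before y x (xs ++ ys)
  Before-++⁺ y∈xs x∈ys = Somewhere-++⁺ y∈xs (refl , ∈-++⁺ʳ _ x∈ys)

  Before-++⁻ : ∀ xs {ys} → Before y x (xs ++ ys) →
               Before y x xs ⊎ Before y x ys ⊎ (y ∈ xs × x ∈ ys)
  Before-++⁻ xs b
    with Somewhere-++⁻ xs (λ t (z≡y , x∈) → Sum.map (z≡y ,_) (z≡y ,_) (∈-++⁻ t x∈)) b
  ... | inj₁ b′                              = inj₁ b′
  ... | inj₂ (inj₁ b′)                       = inj₂ (inj₁ b′)
  ... | inj₂ (inj₂ (_ , y∈xs , refl , x∈ys)) = inj₂ (inj₂ (y∈xs , x∈ys))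

  Before-∈ : ∀ {xs} → Before y x xs → x ∈ xs
  Before-∈ (here (_ , x∈)) = there x∈
  Before-∈ (there b)       = there (Before-∈ b)

  Bridge-∈ : ∀ {xs} → Bridge y x xs → x ∈ xs
  Bridge-∈ (here (_ , x∈))  = there x∈
  Bridge-∈ (there b)        = there (Bridge-∈ b)

  ¬Bridge-≤ : ∀ {xs} → All (_≤ y) xs → ¬ Bridge y x xs
  ¬Bridge-≤ (w≤y ∷ _)   (here (y<w , _)) = <⇒≱ y<w w≤y
  ¬Bridge-≤ (_ ∷ xs≤y) (there b)        = ¬Bridge-≤ xs≤y b

  Bridge-++⁺ˡ : ∀ {xs ys} → Bridge y x xs → Bridge y x (xs ++ ys)
  Bridge-++⁺ˡ = Somewhere-++⁺ˡ λ (y<w , x∈t) → y<w , ∈-++⁺ˡ x∈t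

  Bridge-++⁻ : ∀ xs {ys} → Bridge y x (xs ++ ys) → Bridge y x xs ⊎ x ∈ ys
  Bridge-++⁻ xs b with Somewhere-++⁻ xs (λ t (y<w , x∈) → Sum.map₁ (y<w ,_) (∈-++⁻ t x∈)) b
  ... | inj₁ b′                    = inj₁ b′
  ... | inj₂ (inj₁ b′)             = inj₂ (Bridge-∈ b′)
  ... | inj₂ (inj₂ (_ , _ , x∈ys)) = inj₂ x∈ys

  Bridged-++⁺ˡ : ∀ {xs ys} → Bridged y x xs → Bridged y x (xs ++ ys)
  Bridged-++⁺ˡ = Somewhere-++⁺ˡ λ (z≡y , b) → z≡y , Bridge-++⁺ˡ b

  Bridged-++⁻ : ∀ xs {ys} → Bridged y x (xs ++ ys) →
                Bridged y x xs ⊎ Bridged y x ys ⊎ (y ∈ xs × x ∈ ys)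
  Bridged-++⁻ xs b
    with Somewhere-++⁻ xs (λ t (z≡y , b) → Sum.map (z≡y ,_) (z≡y ,_) (Bridge-++⁻ t b)) b
  ... | inj₁ b′                              = inj₁ b′
  ... | inj₂ (inj₁ b′)                       = inj₂ (inj₁ b′)
  ... | inj₂ (inj₂ (_ , y∈xs , refl , x∈ys)) = inj₂ (inj₂ (y∈xs , x∈ys))

module _ {y x m : ℕ} (x<y : x < y) where

  private
    x≢m : y ≤ m → x ≢ m
    x≢m y≤m = <⇒≢ (<-≤-trans x<y y≤m)

  Before-++-∷ʳ : ∀ {A B} → All (_≤ m) A → All (_≤ m) B →
    Before y x (A ++ B ++ [ m ]) ⇔ (Before y x A ⊎ Before y x B ⊎ (y ∈ A × x ∈ B))
  Before-++-∷ʳ {A} {B} A≤m B≤m = mk⇔ to from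
    where
    to : Before y x (A ++ B ++ [ m ]) → Before y x A ⊎ Before y x B ⊎ (y ∈ A × x ∈ B)
    to b with Before-++⁻ A b
    ... | inj₁ bA = inj₁ bA
    ... | inj₂ (inj₂ (y∈A , x∈Bm)) with ∈-++⁻ B x∈Bm
    ...   | inj₁ x∈B        = inj₂ (inj₂ (y∈A , x∈B))
    ...   | inj₂ (here x≡m) = ⊥-elim (x≢m (All.lookup A≤m y∈A) x≡m)
    to b | inj₂ (inj₁ bBm) with Before-++⁻ B bBm
    ... | inj₁ bB                       = inj₂ (inj₁ bB)
    ... | inj₂ (inj₁ (here (_ , ())))
    ... | inj₂ (inj₁ (there ()))
    ... | inj₂ (inj₂ (y∈B , here x≡m)) = ⊥-elim (x≢m (All.lookup B≤m y∈B) x≡m)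
    from : Before y x A ⊎ Before y x B ⊎ (y ∈ A × x ∈ B) → Before y x (A ++ B ++ [ m ])
    from (inj₁ bA)                = Before-++⁺ˡ bA
    from (inj₂ (inj₁ bB))         = Somewhere-++⁺ʳ A (Before-++⁺ˡ bB)
    from (inj₂ (inj₂ (y∈A , x∈B))) = Before-++⁺ y∈A (∈-++⁺ˡ x∈B)

  Bridged-++-∷ : ∀ {L R} → All (_≤ m) L → All (_≤ m) R → m ∉ L →
    Bridged y x (L ++ m ∷ R) ⇔ (Bridged y x L ⊎ Bridged y x R ⊎ (y ∈ L × x ∈ R))
  Bridged-++-∷ {L} {R} L≤m R≤m m∉L = mk⇔ to from
    where
    to : Bridged y x (L ++ m ∷ R) → Bridged y x L ⊎ Bridged y x R ⊎ (y ∈ L × x ∈ R)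
    to b with Bridged-++⁻ L b
    ... | inj₁ bL                         = inj₁ bL
    ... | inj₂ (inj₁ (there bR))          = inj₂ (inj₁ bR)
    ... | inj₂ (inj₂ (y∈L , there x∈R))   = inj₂ (inj₂ (y∈L , x∈R))
    ... | inj₂ (inj₂ (y∈L , here x≡m))    = ⊥-elim (x≢m (All.lookup L≤m y∈L) x≡m)
    ... | inj₂ (inj₁ (here (refl , bR))) = ⊥-elim (¬Bridge-≤ R≤m bR)
    from : Bridged y x L ⊎ Bridged y x R ⊎ (y ∈ L × x ∈ R) → Bridged y x (L ++ m ∷ R)
    from (inj₁ bL)                = Bridged-++⁺ˡ bL
    from (inj₂ (inj₁ bR))         = Somewhere-++⁺ʳ L (there bR)
    from (inj₂ (inj₂ (y∈L , x∈R))) =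
      Somewhere-++⁺ y∈L (refl , Somewhere-++⁺ʳ _ (here (y<m , x∈R)))
      where
      y<m : y < m
      y<m = ≤∧≢⇒< (All.lookup L≤m y∈L) λ { refl → m∉L y∈L }

∈-stackSortFuel : ∀ k xs {z} → z ∈ stackSortFuel k xs ⇔ z ∈ xs
∈-stackSortFuel k xs = mk⇔ (∈-resp-↭ (stackSortFuel-↭ k xs)) (∈-resp-↭ (↭-sym (stackSortFuel-↭ k xs)))

stackSortFuel-Before : ∀ {y x} → x < y → ∀ k xs → length xs ≤ k →
                       Before y x (stackSortFuel k xs) ⇔ Bridged y x xs
stackSortFuel-Before x<y k [] _ = mk⇔ (λ ()) (λ ())
stackSortFuel-Before {y} {x} x<y (suc k) (z ∷ zs) (s≤s |zs|≤k) = begin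
  Before y x (stackSortFuel k left ++ stackSortFuel k right ++ [ top ])
    ∼⟨ Before-++-∷ʳ x<y (sorted-≤ left left≤top) (sorted-≤ right right≤top) ⟩
  (Before y x (stackSortFuel k left) ⊎ Before y x (stackSortFuel k right) ⊎
    (y ∈ stackSortFuel k left × x ∈ stackSortFuel k right))
    ∼⟨ IH left length-left ⊎-⇔ IH right length-right ⊎-⇔
       ∈-stackSortFuel k left ×-⇔ ∈-stackSortFuel k right ⟩
  (Bridged y x left ⊎ Bridged y x right ⊎ (y ∈ left × x ∈ right))
    ∼⟨ ⇔-sym (Bridged-++-∷ x<y left≤top right≤top top∉left) ⟩
  Bridged y x (left ++ top ∷ right)
    ≡⟨ cong (Bridged y x) split-≡ ⟨
  Bridged y x (z ∷ zs) ∎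
  where
  open MaxSplit z zs
  open EquationalReasoning
  sorted-≤ : ∀ xs → All (_≤ top) xs → All (_≤ top) (stackSortFuel k xs)
  sorted-≤ xs = All-resp-↭ (↭-sym (stackSortFuel-↭ k xs))
  IH : ∀ xs → length xs ≤ length zs → Before y x (stackSortFuel k xs) ⇔ Bridged y x xs
  IH xs |xs|≤ = stackSortFuel-Before x<y k xs (≤-trans |xs|≤ |zs|≤k)

Bridge⇒Before : ∀ {y x xs} → Bridge y x xs → ∃[ w ] (y < w × w ∈ xs × Before w x xs)
Bridge⇒Before (here (y<w , x∈)) = _ , y<w , here refl , here (refl , x∈)
Bridge⇒Before (there b) with Bridge⇒Before b
... | w , y<w , w∈ , bw = w , y<w , there w∈ , there bw

Bridged⇒Before : ∀ {y x xs} → Bridged y x xs → ∃[ w ] (y < w × Before y w xs × Before w x xs)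
Bridged⇒Before (here (refl , b)) with Bridge⇒Before b
... | w , y<w , w∈ , bw = w , y<w , here (refl , w∈) , there bw
Bridged⇒Before (there b) with Bridged⇒Before b
... | w , y<w , byw , bwx = w , y<w , there byw , there bwx

Before⇒Bridged : ∀ {y w x xs} → Unique xs → y < w → Before y w xs → Before w x xs → Bridged y x xs
Before⇒Bridged _ y<w (here (refl , _)) (here (refl , _)) = ⊥-elim (<-irrefl refl y<w)
Before⇒Bridged _ y<w (here (refl , _)) (there bwx) =
  here (refl , Somewhere-map (λ { (refl , x∈) → y<w , x∈ }) bwx)
Before⇒Bridged (w∉ ∷ _) y<w (there byw) (here (refl , _)) = ⊥-elim (All.lookup w∉ (Before-∈ byw) refl)
Before⇒Bridged (_ ∷ u) y<w (there byw) (there bwx) = there (Before⇒Bridged u y<w byw bwx)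

-- Positions in lists without repeated entries

Unique-resp-↭ : ∀ {xs ys : List ℕ} → xs ↭ ys → Unique xs → Unique ys
Unique-resp-↭ xs↭ys = Setoid.Unique-resp-↭ (↭⇒↭ₛ xs↭ys)

IsPerm⇒Unique : ∀ {n xs} → IsPerm n xs → Unique xs
IsPerm⇒Unique {n} p = Unique-resp-↭ (↭-sym p) (Unique.map⁺ suc-injective (Unique.upTo⁺ n))

IsPerm-∈ : ∀ {n xs z} → IsPerm n xs → z ∈ xs → 1 ≤ z × z ≤ n
IsPerm-∈ p z∈ with ∈-map⁻ suc (∈-resp-↭ p z∈)
... | _ , i∈ , refl = s≤s z≤n , ∈-upTo⁻ i∈

Before⇒LeftOf : ∀ {y x xs} → Before y x xs → LeftOf xs y x
Before⇒LeftOf (here (refl , x∈)) = zero , suc (index x∈) , refl , sym (lookup-index x∈) , s≤s z≤n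
Before⇒LeftOf (there b) with Before⇒LeftOf b
... | i , j , xsᵢ≡y , xsⱼ≡x , i<j = suc i , suc j , xsᵢ≡y , xsⱼ≡x , s≤s i<j

LeftOf⇒Before : ∀ {y x xs} → LeftOf xs y x → Before y x xs
LeftOf⇒Before {xs = _ ∷ xs} (zero  , suc j , refl , xsⱼ≡x , _) = here (refl , subst (_∈ xs) xsⱼ≡x (∈-lookup j))
LeftOf⇒Before {xs = _ ∷ _} (suc i , suc j , xsᵢ≡y , xsⱼ≡x , s≤s i<j) =
  there (LeftOf⇒Before (i , j , xsᵢ≡y , xsⱼ≡x , i<j))

LeftOf-∈ˡ : ∀ {xs a b} → LeftOf xs a b → a ∈ xs
LeftOf-∈ˡ {xs} (i , _ , refl , _) = ∈-lookup i

LeftOf-∈ʳ : ∀ {xs a b} → LeftOf xs a b → b ∈ xs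
LeftOf-∈ʳ {xs} (_ , j , _ , refl , _) = ∈-lookup j

lookup-injective : ∀ {xs : List ℕ} → Unique xs → ∀ {i j} → lookup xs i ≡ lookup xs j → i ≡ j
lookup-injective {_ ∷ _} _          {zero}  {zero}  _ = refl
lookup-injective {_ ∷ _} (x∉ ∷ _)  {zero}  {suc j} e = ⊥-elim (All.lookup x∉ (∈-lookup j) e)
lookup-injective {_ ∷ _} (x∉ ∷ _)  {suc i} {zero}  e = ⊥-elim (All.lookup x∉ (∈-lookup i) (sym e))
lookup-injective {_ ∷ _} (_ ∷ u)   {suc i} {suc j} e = cong suc (lookup-injective u e)

module _ {xs : List ℕ} (u : Unique xs) where

  LeftOf-positions : ∀ {i j} → LeftOf xs (lookup xs i) (lookup xs j) → toℕ i < toℕ j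
  LeftOf-positions (i′ , j′ , xsᵢ′≡ , xsⱼ′≡ , i′<j′)
    with lookup-injective u xsᵢ′≡ | lookup-injective u xsⱼ′≡
  ... | refl | refl = i′<j′

  LeftOf-irrefl : ∀ {a} → ¬ LeftOf xs a a
  LeftOf-irrefl (i , j , refl , xsⱼ≡ , i<j) with lookup-injective u xsⱼ≡
  ... | refl = <-irrefl refl i<j

  LeftOf-trans : ∀ {a b c} → LeftOf xs a b → LeftOf xs b c → LeftOf xs a c
  LeftOf-trans (i , j , xsᵢ≡a , refl , i<j) (j′ , k , xsⱼ′≡ , xsₖ≡c , j′<k)
    with lookup-injective u xsⱼ′≡
  ... | refl = i , k , xsᵢ≡a , xsₖ≡c , <-trans i<j j′<k

  LeftOf-total : ∀ {a b} → a ∈ xs → b ∈ xs → a ≢ b → LeftOf xs a b ⊎ LeftOf xs b a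
  LeftOf-total a∈ b∈ a≢b with <-cmp (toℕ (index a∈)) (toℕ (index b∈))
  ... | tri< i<j _ _ = inj₁ (index a∈ , index b∈ , sym (lookup-index a∈) , sym (lookup-index b∈) , i<j)
  ... | tri> _ _ j<i = inj₂ (index b∈ , index a∈ , sym (lookup-index b∈) , sym (lookup-index a∈) , j<i)
  ... | tri≈ _ i≡j _ =
    ⊥-elim (a≢b (trans (lookup-index a∈) (trans (cong (lookup xs) (toℕ-injective i≡j)) (sym (lookup-index b∈)))))

  LeftOf-between : ∀ {i j z} → LeftOf xs (lookup xs i) z → LeftOf xs z (lookup xs j) →
                   ∃[ k ] (lookup xs k ≡ z × toℕ i < toℕ k × toℕ k < toℕ j)
  LeftOf-between iz@(_ , k , _ , refl , _) zj = k , refl , LeftOf-positions iz , LeftOf-positions zj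

IsMaxBetween : List ℕ → ℕ → ℕ → ℕ → Set
IsMaxBetween xs a b g =
  LeftOf xs a g × LeftOf xs g b × (∀ {z} → LeftOf xs a z → LeftOf xs z b → z ≤ g)

maxBetween : ∀ {xs a z b} → Unique xs → LeftOf xs a z → LeftOf xs z b → ∃[ g ] IsMaxBetween xs a b g
maxBetween {xs} u az@(i , k , refl , refl , _) zb@(_ , j , _ , refl , _) =
  lookup xs g , (i , g , refl , refl , proj₁ g-inside) , (g , j , refl , refl , proj₂ g-inside) , ≤g
  where
  Inside : Fin (length xs) → Set
  Inside t = toℕ i < toℕ t × toℕ t < toℕ j
  inside? : Decidable Inside
  inside? t = toℕ i <? toℕ t ×-dec toℕ t <? toℕ j
  candidates : List (Fin (length xs))
  candidates = filter inside? (allFin (length xs))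
  g : Fin (length xs)
  g = argmax (lookup xs) k candidates
  g-inside : Inside g
  g-inside = argmax-all (lookup xs) (LeftOf-positions u az , LeftOf-positions u zb) (all-filter inside? (allFin (length xs)))
  ≤g : ∀ {z} → LeftOf xs (lookup xs i) z → LeftOf xs z (lookup xs j) → z ≤ lookup xs g
  ≤g iz zj with LeftOf-between u iz zj
  ... | t , refl , t-inside =
    All.lookup (f[xs]≤f[argmax] k candidates) (∈-filter⁺ inside? (∈-allFin t) t-inside)

-- Occurrences of 32\bar{4}1 in σ and in s(σ)

Pattern3241 : List ℕ → ℕ → ℕ → ℕ → Set
Pattern3241 xs c d e = LeftOf xs c d × LeftOf xs d e × e < d × d < c ×
  (∀ {z} → LeftOf xs d z → LeftOf xs z e → z < c)

module _ {xs : List ℕ} (u : Unique xs) where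

  Occ3241⇒Pattern3241 : ∀ {i₁ i₂ i₃} → Occ3241 xs i₁ i₂ i₃ →
    Pattern3241 xs (lookup xs i₁) (lookup xs i₂) (lookup xs i₃)
  Occ3241⇒Pattern3241 {i₁} {i₂} {i₃} (i₁<i₂ , i₂<i₃ , v₂<v₁ , v₃<v₂ , barred) =
    (i₁ , i₂ , refl , refl , i₁<i₂) , (i₂ , i₃ , refl , refl , i₂<i₃) , v₃<v₂ , v₂<v₁ , barred′
    where
    barred′ : ∀ {z} → LeftOf xs (lookup xs i₂) z → LeftOf xs z (lookup xs i₃) → z < lookup xs i₁
    barred′ i₂z zi₃ with LeftOf-between u i₂z zi₃
    ... | k , refl , i₂<k , k<i₃ = barred k i₂<k k<i₃

  Pattern3241⇒Occ3241 : ∀ {c d e} → Pattern3241 xs c d e →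
    ∃[ i₁ ] ∃[ i₂ ] ∃[ i₃ ] (Occ3241 xs i₁ i₂ i₃ × lookup xs i₃ ≡ e)
  Pattern3241⇒Occ3241 ((i₁ , i₂ , refl , refl , i₁<i₂) , (i₂′ , i₃ , xs₂′≡ , refl , i₂′<i₃) , e<d , d<c , barred)
    with lookup-injective u xs₂′≡
  ... | refl = i₁ , i₂ , i₃ , (i₁<i₂ , i₂′<i₃ , d<c , e<d ,
                 λ k i₂<k k<i₃ → barred (i₂ , k , refl , refl , i₂<k) (k , i₃ , refl , refl , k<i₃)) , refl

module _ {σ : List ℕ} (u : Unique σ) where

  private
    uₛ : Unique (s σ)
    uₛ = Unique-resp-↭ (↭-sym (stackSortFuel-↭ (length σ) σ)) u

    ∈-s : ∀ {z} → z ∈ s σ ⇔ z ∈ σ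
    ∈-s = ∈-stackSortFuel (length σ) σ

  LeftOf-s : ∀ {y x} → x < y → LeftOf (s σ) y x ⇔ (∃[ w ] (y < w × LeftOf σ y w × LeftOf σ w x))
  LeftOf-s {y} {x} x<y = mk⇔ to from
    where
    s-Before : Before y x (s σ) ⇔ Bridged y x σ
    s-Before = stackSortFuel-Before x<y (length σ) σ ≤-refl
    to : LeftOf (s σ) y x → ∃[ w ] (y < w × LeftOf σ y w × LeftOf σ w x)
    to yx with Bridged⇒Before (Equivalence.to s-Before (LeftOf⇒Before yx))
    ... | w , y<w , yw , wx = w , y<w , Before⇒LeftOf yw , Before⇒LeftOf wx
    from : ∃[ w ] (y < w × LeftOf σ y w × LeftOf σ w x) → LeftOf (s σ) y x
    from (w , y<w , yw , wx) = Before⇒LeftOf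
      (Equivalence.from s-Before (Before⇒Bridged u y<w (LeftOf⇒Before yw) (LeftOf⇒Before wx)))

  maxBetween-after-in-s : ∀ {a x g} → IsMaxBetween σ a x g → x < g → LeftOf (s σ) x g
  maxBetween-after-in-s (ag , gx , ≤g) x<g
    with LeftOf-total uₛ (Equivalence.from ∈-s (LeftOf-∈ʳ gx)) (Equivalence.from ∈-s (LeftOf-∈ˡ gx)) (<⇒≢ x<g)
  ... | inj₁ xg = xg
  ... | inj₂ gx′ with Equivalence.to (LeftOf-s x<g) gx′
  ...   | w , g<w , gw , wx = ⊥-elim (<⇒≱ g<w (≤g (LeftOf-trans u ag gw) wx))

  maxBetween-exceeds : ∀ {a x} → x < a → LeftOf (s σ) a x → ∃[ g ] (IsMaxBetween σ a x g × a < g)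
  maxBetween-exceeds x<a ax with Equivalence.to (LeftOf-s x<a) ax
  ... | w , a<w , aw , wx with maxBetween u aw wx
  ...   | g , isMax@(_ , _ , ≤g) = g , isMax , <-≤-trans a<w (≤g aw wx)

  maxBetween-precedes-middle : ∀ {a b e c} → Pattern3241 (s σ) a b e →
    IsMaxBetween σ a e c → a < c → LeftOf σ c b
  maxBetween-precedes-middle {b = b} {e} {c} (ab , _ , e<b , b<a , barred) (ac , ce , ≤c) a<c
    with LeftOf-total u (Equivalence.to ∈-s (LeftOf-∈ʳ ab)) (LeftOf-∈ˡ ce) (<⇒≢ (<-trans b<a a<c))
  ... | inj₂ cb = cb
  ... | inj₁ bc with maxBetween-exceeds b<a ab
  ...   | g , isMax@(ag , gb , _) , a<g = ⊥-elim (<-asym a<g (barred bg ge))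
    where
    gc : LeftOf σ g c
    gc = LeftOf-trans u gb bc
    g<c : g < c
    g<c = ≤∧≢⇒< (≤c ag (LeftOf-trans u gc ce)) λ { refl → LeftOf-irrefl u gc }
    bg : LeftOf (s σ) b g
    bg = maxBetween-after-in-s isMax (<-trans b<a a<g)
    ge : LeftOf (s σ) g e
    ge = Equivalence.from (LeftOf-s (<-trans e<b (<-trans b<a a<g))) (c , g<c , gc , ce)

  large-entry-after-maxBetween : ∀ {a b e c} → Pattern3241 (s σ) a b e →
    IsMaxBetween σ a e c → a < c → ∃[ z ] (LeftOf σ c z × LeftOf σ z e × suc e < z)
  large-entry-after-maxBetween p@(_ , be , e<b , _) isMax a<c with Equivalence.to (LeftOf-s e<b) be
  ... | w , b<w , bw , we =
    w , LeftOf-trans u (maxBetween-precedes-middle p isMax a<c) bw , we , ≤-<-trans e<b b<w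

  Pattern3241-s⁻ : ∀ {a b e} → Pattern3241 (s σ) a b e →
    ∃[ c ] ∃[ d ] (Pattern3241 σ c d e × suc e < d × LeftOf (s σ) e c × LeftOf (s σ) e d)
  Pattern3241-s⁻ {e = e} p@(ab , be , e<b , b<a , _)
    with maxBetween-exceeds (<-trans e<b b<a) (LeftOf-trans uₛ ab be)
  ... | c , isMaxᶜ@(ac , _ , ≤c) , a<c with large-entry-after-maxBetween p isMaxᶜ a<c
  ...   | z , cz , ze , 1+e<z with maxBetween u cz ze
  ...     | d , isMaxᵈ@(cd , de , ≤d) =
    c , d , (cd , de , e<d , d<c , λ dz′ z′e → ≤-<-trans (≤d (LeftOf-trans u cd dz′) z′e) d<c) ,
    1+e<d , maxBetween-after-in-s isMaxᶜ (<-trans e<d d<c) , maxBetween-after-in-s isMaxᵈ e<d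
    where
    1+e<d : suc e < d
    1+e<d = <-≤-trans 1+e<z (≤d cz ze)
    e<d : e < d
    e<d = <-trans (n<1+n e) 1+e<d
    d<c : d < c
    d<c = ≤∧≢⇒< (≤c (LeftOf-trans u ac cd) de) λ { refl → LeftOf-irrefl u cd }

Contains3241With1⇒Pattern3241 : ∀ {n xs} → IsPerm n xs → Contains3241With1 xs →
  ∃[ a ] ∃[ b ] Pattern3241 xs a b 1
Contains3241With1⇒Pattern3241 {xs = xs} p (i₁ , i₂ , i₃ , occ@(_ , _ , v₂<v₁ , v₃<v₂ , _) , involves1) =
  _ , _ , subst (Pattern3241 xs _ _) (last≡1 involves1) (Occ3241⇒Pattern3241 (IsPerm⇒Unique p) occ)
  where
  middle>1 : ¬ lookup xs i₂ ≤ 1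
  middle>1 v₂≤1 = <⇒≱ (<-≤-trans v₃<v₂ v₂≤1) (proj₁ (IsPerm-∈ p (∈-lookup i₃)))
  last≡1 : lookup xs i₁ ≡ 1 ⊎ lookup xs i₂ ≡ 1 ⊎ lookup xs i₃ ≡ 1 → lookup xs i₃ ≡ 1
  last≡1 (inj₁ v₁≡1)         = ⊥-elim (middle>1 (<⇒≤ (subst (_ <_) v₁≡1 v₂<v₁)))
  last≡1 (inj₂ (inj₁ v₂≡1))  = ⊥-elim (middle>1 (≤-reflexive v₂≡1))
  last≡1 (inj₂ (inj₂ v₃≡1))  = v₃≡1

lemma3p4 : (n : ℕ) (π σ : List ℕ) → IsPerm n π → IsPerm n σ →
    Contains3241With1 π → s σ ≡ π →
    Contains3241With1 σ ×
    (∃[ c ] ∃[ d ] (c ≢ d × 3 ≤ c × c ≤ n × 3 ≤ d × d ≤ n ×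
      LeftOf σ c 1 × LeftOf π 1 c × LeftOf σ d 1 × LeftOf π 1 d))
lemma3p4 n _ σ pπ pσ π-contains refl =
  let uσ = IsPerm⇒Unique pσ
      _ , _ , π-pattern = Contains3241With1⇒Pattern3241 pπ π-contains
      c , d , σ-pattern , 2<d , 1c , 1d = Pattern3241-s⁻ uσ π-pattern
      cd , d1 , _ , d<c , _ = σ-pattern
      i₁ , i₂ , i₃ , occ , σᵢ₃≡1 = Pattern3241⇒Occ3241 uσ σ-pattern
      ≤n : ∀ {z} → z ∈ σ → z ≤ n
      ≤n z∈ = proj₂ (IsPerm-∈ pσ z∈)
  in (i₁ , i₂ , i₃ , occ , inj₂ (inj₂ σᵢ₃≡1)) ,
     c , d , >⇒≢ d<c ,
     <-trans 2<d d<c , ≤n (LeftOf-∈ˡ cd) , 2<d , ≤n (LeftOf-∈ʳ cd) ,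
     LeftOf-trans uσ cd d1 , 1c , d1 , 1d
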